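{- Let $\mathbf{L}$ be an intermediate logic, $\mathbf{LJL}_0\in\{\mathbf{LJ}_0,\mathbf{LJT}_0,\mathbf{LJ4}_0,\mathbf{LJT4}_0\}$ and $CS$ a constant specification for $\mathbf{LJL}_0$. Let $\mathsf C$ be a class of Kripke frames such that $\mathbf L$ is both strongly complete and strongly globally complete with respect to $\mathsf C$, and let $\mathsf{CKMJL}$ be the class of intuitionistic Mkrtychev models over frames in $\mathsf C$ corresponding to $\mathbf{LJL}_0$ (all for $\mathbf{LJ}_0$; factive for $\mathbf{LJT}_0$; introspective for $\mathbf{LJ4}_0$; factive and introspective for $\mathbf{LJT4}_0$), and $\mathsf{CKMJL}_{CS}$ its subclass of models respecting $CS$. Then for any $\Gamma\cup\{\phi\}\subseteq\mathcal L_J$: $\Gamma\vdash_{\mathbf{LJL}_{CS}}\phi$ iff $\Gamma\models_{\mathsf{CKMJL}_{CS}}\phi$.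
   Context: Intermediate logic $\mathbf L\subsetneq\mathcal L_0$ (propositional language over $Var=\{p_i\}$ with $\bot,\land,\lor,\to$): contains all instances of the standard intuitionistic axiom schemes ($\phi\to(\psi\to\phi)$; $(\phi\to(\chi\to\psi))\to((\phi\to\chi)\to(\phi\to\psi))$; $(\phi\land\psi)\to\phi$; $(\phi\land\psi)\to\psi$; $\phi\to(\psi\to(\phi\land\psi))$; $\phi\to(\phi\lor\psi)$; $\psi\to(\phi\lor\psi)$; $(\phi\to\psi)\to((\chi\to\psi)\to((\phi\lor\chi)\to\psi))$; $\bot\to\phi$), closed under modus ponens and substitution; $\Gamma\vdash_{\mathbf L}\phi$ iff $\bigwedge_{i\le n}\gamma_i\to\phi\in\mathbf L$ for some $\gamma_i\in\Gamma$ ($n\ge 0$). A Kripke frame is a partial order $\langle F,\le\rangle$, $F\neq\emptyset$; a propositional Kripke model over it is a monotone relation $\Vdash\subseteq F\times Var$ ($x\le y$, $x\Vdash p$ imply $y\Vdash p$), with the usual intuitionistic satisfaction ($x\models\phi\to\psi$ iff for all $y\ge x$, $y\models\phi$ implies $y\models\psi$). $\mathbf L$ is strongly complete w.r.t. $\mathsf C$ iff $\Gamma\vdash_{\mathbf L}\phi$ is equivalent to: for every model over a frame in $\mathsf C$ and every world $x$, if $x$ satisfies $\Gamma$ then $x\models\phi$; strongly globally complete iff $\Gamma\vdash_{\mathbf L}\phi$ is equivalent to: for every model over a frame in $\mathsf C$, if all worlds satisfy $\Gamma$ then all worlds satisfy $\phi$. Terms $Jt$: $t::=x\mid c\mid[t+t]\mid[t\cdot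 t]\mid\,!t$ ($x\in V=\{x_i\}$, $c\in C=\{c_i\}$); $\mathcal L_J$: $\phi::=\bot\mid p\mid\phi\land\phi\mid\phi\lor\phi\mid\phi\to\phi\mid t:\phi$. $\overline{\mathbf L}$: all $\sigma(\psi)$, $\psi\in\mathbf L$, $\sigma:Var\to\mathcal L_J$. Schemes $(J)$ $t:(\phi\to\psi)\to(s:\phi\to[t\cdot s]:\psi)$; $(+)$ $t:\phi\to[t+s]:\phi$, $t:\phi\to[s+t]:\phi$; $(F)$ $t:\phi\to\phi$; $(I)$ $t:\phi\to\,!t:t:\phi$. $\mathbf{LJ}_0$ = closure of $\overline{\mathbf L}\cup(J)\cup(+)$ under modus ponens; $\mathbf{LJT}_0$ adds $(F)$, $\mathbf{LJ4}_0$ adds $(I)$, $\mathbf{LJT4}_0$ both. Constant specification for $\mathbf{LJL}_0$: a set of formulas $c_{i_n}:\dots:c_{i_1}:\phi$ ($n\ge1$) with $\phi\in\overline{\mathbf L}$ or an instance of a justification scheme of $\mathbf{LJL}_0$. $\Gamma\vdash_{\mathbf{LJL}_{CS}}\phi$ iff $\bigwedge_{i\le n}\gamma_i\to\phi\in\mathbf{LJL}_0$ for some $\gamma_i\in\Gamma\cup CS$ ($n\ge 0$). An intuitionistic Mkrtychev model over a frame $\langle F,\le\rangle$ is $\langle F,\le,\mathcal E,\Vdash\rangle$ with $\Vdash\subseteq F\times Var$ and $\mathcal E:Jt\times F\to 2^{\mathcal L_J}$ such that for $x\le y$: $x\Vdash p$ implies $y\Vdash p$, and $\mathcal E_t(x)\subseteq\mathcal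 E_t(y)$; and for all $x,t,s$: $\mathcal E_t(x)\sqsupset\mathcal E_s(x)\subseteq\mathcal E_{[t\cdot s]}(x)$ and $\mathcal E_t(x)\cup\mathcal E_s(x)\subseteq\mathcal E_{[t+s]}(x)$, where $\Gamma\sqsupset\Delta=\{\phi\mid\exists\psi:\psi\to\phi\in\Gamma,\psi\in\Delta\}$. Satisfaction at $x\in F$: intuitionistic clauses for $\bot,p,\land,\lor,\to$ (with $\to$ quantifying over $y\ge x$), and $x\models t:\phi$ iff $\phi\in\mathcal E_t(x)$. Factive: $\phi\in\mathcal E_t(x)$ implies $x\models\phi$. Introspective: $\{t:\phi\mid\phi\in\mathcal E_t(x)\}\subseteq\mathcal E_{!t}(x)$. Respects $CS$: $\phi\in\mathcal E_c(x)$ for all $x$ and all $c:\phi\in CS$. $\Gamma\models_{\mathsf K}\phi$ iff for all models in $\mathsf K$ and all worlds $x$, if $x$ satisfies every $\gamma\in\Gamma$ then $x\models\phi$. -}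

module Defs where

open import Data.Nat using (ℕ)
open import Data.List using (List; []; _∷_)
open import Data.List.Relation.Unary.All using (All)
open import Data.Unit using (⊤)
open import Data.Product using (Σ; ∃; _×_; _,_)
open import Data.Sum using (_⊎_)
open import Data.Empty using (⊥)
open import Relation.Nullary using (¬_)
open import Relation.Binary.PropositionalEquality using (_≡_)
open import Relation.Binary.Structures using (IsPartialOrder)

infixr 6 _∧₀_
infixr 5 _∨₀_
infixr 4 _⇒₀_

data Fm₀ : Set where
  ⊥₀   : Fm₀
  p₀   : ℕ → Fm₀
  _∧₀_ : Fm₀ → Fm₀ → Fm₀
  _∨₀_ : Fm₀ → Fm₀ → Fm₀
  _⇒₀_ : Fm₀ → Fm₀ → Fm₀

subst₀ : (ℕ → Fm₀) → Fm₀ → Fm₀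
subst₀ σ ⊥₀ = ⊥₀
subst₀ σ (p₀ i) = σ i
subst₀ σ (φ ∧₀ ψ) = subst₀ σ φ ∧₀ subst₀ σ ψ
subst₀ σ (φ ∨₀ ψ) = subst₀ σ φ ∨₀ subst₀ σ ψ
subst₀ σ (φ ⇒₀ ψ) = subst₀ σ φ ⇒₀ subst₀ σ ψ

data IntAx : Fm₀ → Set where
  ax1 : ∀ φ ψ → IntAx (φ ⇒₀ (ψ ⇒₀ φ))
  ax2 : ∀ φ χ ψ → IntAx ((φ ⇒₀ (χ ⇒₀ ψ)) ⇒₀ ((φ ⇒₀ χ) ⇒₀ (φ ⇒₀ ψ)))
  ax3 : ∀ φ ψ → IntAx ((φ ∧₀ ψ) ⇒₀ φ)
  ax4 : ∀ φ ψ → IntAx ((φ ∧₀ ψ) ⇒₀ ψ)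
  ax5 : ∀ φ ψ → IntAx (φ ⇒₀ (ψ ⇒₀ (φ ∧₀ ψ)))
  ax6 : ∀ φ ψ → IntAx (φ ⇒₀ (φ ∨₀ ψ))
  ax7 : ∀ φ ψ → IntAx (ψ ⇒₀ (φ ∨₀ ψ))
  ax8 : ∀ φ ψ χ → IntAx ((φ ⇒₀ ψ) ⇒₀ ((χ ⇒₀ ψ) ⇒₀ ((φ ∨₀ χ) ⇒₀ ψ)))
  ax9 : ∀ φ → IntAx (⊥₀ ⇒₀ φ)

record IntermediateLogic (L : Fm₀ → Set) : Set where
  field
    axioms : ∀ φ → IntAx φ → L φ
    mp     : ∀ φ ψ → L (φ ⇒₀ ψ) → L φ → L ψ
    subst  : ∀ (σ : ℕ → Fm₀) φ → L φ → L (subst₀ σ φ)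
    proper : ∃ λ φ → ¬ L φ

⋀₀ : List Fm₀ → Fm₀
⋀₀ [] = ⊥₀ ⇒₀ ⊥₀
⋀₀ (γ ∷ []) = γ
⋀₀ (γ ∷ γs) = γ ∧₀ ⋀₀ γs

_⊢[_]_ : (Fm₀ → Set) → (Fm₀ → Set) → Fm₀ → Set
Γ ⊢[ L ] φ = Σ (List Fm₀) λ γs → All Γ γs × L (⋀₀ γs ⇒₀ φ)

record Frame : Set₁ where
  field
    W       : Set
    _≤_     : W → W → Set
    isPO    : IsPartialOrder _≡_ _≤_
    inhabit : W

record KModel (F : Frame) : Set₁ where
  open Frame F
  field
    _⊩_  : W → ℕ → Set
    mono : ∀ {x y i} → x ≤ y → x ⊩ i → y ⊩ i

module _ {F : Frame} (M : KModel F) where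
  open Frame F
  open KModel M
  _⊨₀_ : W → Fm₀ → Set
  x ⊨₀ ⊥₀ = ⊥
  x ⊨₀ p₀ i = x ⊩ i
  x ⊨₀ (φ ∧₀ ψ) = (x ⊨₀ φ) × (x ⊨₀ ψ)
  x ⊨₀ (φ ∨₀ ψ) = (x ⊨₀ φ) ⊎ (x ⊨₀ ψ)
  x ⊨₀ (φ ⇒₀ ψ) = ∀ y → x ≤ y → y ⊨₀ φ → y ⊨₀ ψ

StronglyComplete : (L : Fm₀ → Set) → (Frame → Set) → Set₁
StronglyComplete L C =
  ∀ (Γ : Fm₀ → Set) φ →
    (Γ ⊢[ L ] φ → ∀ F → C F → (M : KModel F) → ∀ x →
        (∀ γ → Γ γ → _⊨₀_ M x γ) → _⊨₀_ M x φ)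
  × ((∀ F → C F → (M : KModel F) → ∀ x →
        (∀ γ → Γ γ → _⊨₀_ M x γ) → _⊨₀_ M x φ) → Γ ⊢[ L ] φ)

StronglyGloballyComplete : (L : Fm₀ → Set) → (Frame → Set) → Set₁
StronglyGloballyComplete L C =
  ∀ (Γ : Fm₀ → Set) φ →
    (Γ ⊢[ L ] φ → ∀ F → C F → (M : KModel F) →
        (∀ x γ → Γ γ → _⊨₀_ M x γ) → ∀ x → _⊨₀_ M x φ)
  × ((∀ F → C F → (M : KModel F) →
        (∀ x γ → Γ γ → _⊨₀_ M x γ) → ∀ x → _⊨₀_ M x φ) → Γ ⊢[ L ] φ)

infixl 7 _⊙_
infixl 6 _⊕_

data Tm : Set where
  vr  : ℕ → Tm
  cn  : ℕ → Tm
  _⊕_ : Tm → Tm → Tm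
  _⊙_ : Tm → Tm → Tm
  !_  : Tm → Tm

infixr 6 _∧ⱼ_
infixr 5 _∨ⱼ_
infixr 4 _⇒ⱼ_
infixr 8 _∶_

data FmJ : Set where
  ⊥ⱼ   : FmJ
  pⱼ   : ℕ → FmJ
  _∧ⱼ_ : FmJ → FmJ → FmJ
  _∨ⱼ_ : FmJ → FmJ → FmJ
  _⇒ⱼ_ : FmJ → FmJ → FmJ
  _∶_  : Tm → FmJ → FmJ

substJ : (ℕ → FmJ) → Fm₀ → FmJ
substJ σ ⊥₀ = ⊥ⱼ
substJ σ (p₀ i) = σ i
substJ σ (φ ∧₀ ψ) = substJ σ φ ∧ⱼ substJ σ ψ
substJ σ (φ ∨₀ ψ) = substJ σ φ ∨ⱼ substJ σ ψ
substJ σ (φ ⇒₀ ψ) = substJ σ φ ⇒ⱼ substJ σ ψ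

Lbar : (Fm₀ → Set) → FmJ → Set
Lbar L φ = Σ Fm₀ λ ψ → Σ (ℕ → FmJ) λ σ → L ψ × (substJ σ ψ ≡ φ)

data Variant : Set where
  LJ LJT LJ4 LJT4 : Variant

HasF : Variant → Set
HasF LJ = ⊥
HasF LJT = ⊤
HasF LJ4 = ⊥
HasF LJT4 = ⊤

HasI : Variant → Set
HasI LJ = ⊥
HasI LJT = ⊥
HasI LJ4 = ⊤
HasI LJT4 = ⊤

data JustAx (v : Variant) : FmJ → Set where
  axJ  : ∀ t s φ ψ → JustAx v (t ∶ (φ ⇒ⱼ ψ) ⇒ⱼ (s ∶ φ ⇒ⱼ (t ⊙ s) ∶ ψ))
  axP₁ : ∀ t s φ → JustAx v (t ∶ φ ⇒ⱼ (t ⊕ s) ∶ φ)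
  axP₂ : ∀ t s φ → JustAx v (t ∶ φ ⇒ⱼ (s ⊕ t) ∶ φ)
  axF  : HasF v → ∀ t φ → JustAx v (t ∶ φ ⇒ⱼ φ)
  axI  : HasI v → ∀ t φ → JustAx v (t ∶ φ ⇒ⱼ (! t) ∶ t ∶ φ)

data LJL₀ (L : Fm₀ → Set) (v : Variant) : FmJ → Set where
  lbar : ∀ φ → Lbar L φ → LJL₀ L v φ
  jax  : ∀ φ → JustAx v φ → LJL₀ L v φ
  mp   : ∀ φ ψ → LJL₀ L v (φ ⇒ⱼ ψ) → LJL₀ L v φ → LJL₀ L v ψ

-- c_{i_n} : … : c_{i_1} : φ  (list given outermost first)
prefixCs : List ℕ → FmJ → FmJ
prefixCs [] φ = φ
prefixCs (i ∷ is) φ = cn i ∶ prefixCs is φ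

IsCS : (Fm₀ → Set) → Variant → (FmJ → Set) → Set
IsCS L v CS = ∀ χ → CS χ →
  Σ ℕ λ i → Σ (List ℕ) λ is → Σ FmJ λ φ →
    (χ ≡ prefixCs (i ∷ is) φ) × (Lbar L φ ⊎ JustAx v φ)

⋀ⱼ : List FmJ → FmJ
⋀ⱼ [] = ⊥ⱼ ⇒ⱼ ⊥ⱼ
⋀ⱼ (γ ∷ []) = γ
⋀ⱼ (γ ∷ γs) = γ ∧ⱼ ⋀ⱼ γs

Derivable : (Fm₀ → Set) → Variant → (FmJ → Set) → (FmJ → Set) → FmJ → Set
Derivable L v CS Γ φ =
  Σ (List FmJ) λ γs → All (λ γ → Γ γ ⊎ CS γ) γs × LJL₀ L v (⋀ⱼ γs ⇒ⱼ φ)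

-- (the clause E_t ⊐ E_s ⊆ E_{t·s} is the field app)
record MModel (F : Frame) : Set₁ where
  open Frame F
  field
    _⊩_   : W → ℕ → Set
    E     : Tm → W → FmJ → Set
    mono⊩ : ∀ {x y i} → x ≤ y → x ⊩ i → y ⊩ i
    monoE : ∀ {x y t φ} → x ≤ y → E t x φ → E t y φ
    app   : ∀ {x t s φ ψ} → E t x (ψ ⇒ⱼ φ) → E s x ψ → E (t ⊙ s) x φ
    sumˡ  : ∀ {x t s φ} → E t x φ → E (t ⊕ s) x φ
    sumʳ  : ∀ {x t s φ} → E s x φ → E (t ⊕ s) x φ

module _ {F : Frame} (M : MModel F) where
  open Frame F
  open MModel M
  _⊨ⱼ_ : W → FmJ → Set
  x ⊨ⱼ ⊥ⱼ = ⊥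
  x ⊨ⱼ pⱼ i = x ⊩ i
  x ⊨ⱼ (φ ∧ⱼ ψ) = (x ⊨ⱼ φ) × (x ⊨ⱼ ψ)
  x ⊨ⱼ (φ ∨ⱼ ψ) = (x ⊨ⱼ φ) ⊎ (x ⊨ⱼ ψ)
  x ⊨ⱼ (φ ⇒ⱼ ψ) = ∀ y → x ≤ y → y ⊨ⱼ φ → y ⊨ⱼ ψ
  x ⊨ⱼ (t ∶ φ) = E t x φ

  Factive : Set
  Factive = ∀ t x φ → E t x φ → x ⊨ⱼ φ

  Introspective : Set
  Introspective = ∀ t x φ → E t x φ → E (! t) x (t ∶ φ)

  RespectsCS : (FmJ → Set) → Set
  RespectsCS CS = ∀ c φ → CS (cn c ∶ φ) → ∀ x → E (cn c) x φ

VariantCond : Variant → {F : Frame} → MModel F → Set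
VariantCond LJ   M = ⊤
VariantCond LJT  M = Factive M
VariantCond LJ4  M = Introspective M
VariantCond LJT4 M = Factive M × Introspective M

SemConseq : (Frame → Set) → Variant → (FmJ → Set) → (FmJ → Set) → FmJ → Set₁
SemConseq C v CS Γ φ =
  ∀ F → C F → (M : MModel F) → VariantCond v M → RespectsCS M CS →
    ∀ x → (∀ γ → Γ γ → _⊨ⱼ_ M x γ) → _⊨ⱼ_ M x φ

module Submission where

-- Soundness: a Mkrtychev model M and a substitution σ : Var → 𝓛_J induce a
-- Kripke model on the same frame in which p_i means "σ(p_i) holds in M"; so a
-- C-valid formula of L (strong completeness with Γ = ∅) stays true in M under
-- every substitution, i.e. M validates L̄.
--
-- Completeness: 𝓛_J is made propositional by a Gödel numbering that turns every
-- atom p_i and t:ψ into its own variable ("skeleton"), keeping variable 0 free.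
-- A Kripke model validating the skeletons of all scheme instances and of CS is
-- read back as a Mkrtychev model with the same truths.  Hence Γ ⊨ φ yields the
-- global consequence  {scheme instances, CS, p₀ → γ | γ ∈ Γ} ⊨ p₀ → φ, which
-- strong global completeness turns into an L-derivation from finitely many
-- premises.  One more valid L-formula ("bridge") rearranges these premises; the
-- substitution decoding the skeleton (sending p₀ to ⊤) maps both L-theorems
-- into LJL₀, and discharging the scheme instances gives  ⋀ Δ → φ  with Δ ⊆ Γ ∪ CS.

open import Defs
open import Data.Nat using (ℕ; zero; suc)
open import Data.Nat.Properties using (n<1+n)
open import Data.List using (List; []; _∷_; map)
open import Data.List.Relation.Unary.All using (All; []; _∷_)
import Data.List.Relation.Unary.All as All
open import Data.List.Relation.Unary.All.Properties using (map⁻)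
open import Data.Unit using (tt)
open import Data.Product using (_×_; _,_; proj₁; proj₂)
open import Data.Sum using (_⊎_; inj₁; inj₂)
open import Data.Empty using (⊥)
open import Relation.Binary.PropositionalEquality
  using (_≡_; refl; cong; cong₂; subst; module ≡-Reasoning)
open import Relation.Binary.Structures using (IsPartialOrder)

-- A Gödel numbering of terms and formulas with a decoder that inverts it; it
-- makes the skeleton below injective on atoms.
module GödelNumbering where

  open import Data.Nat using (_+_; _≤_; _<_; z≤n; s≤s)
  open import Data.Nat.Properties
    using (≤-trans; ≤-<-trans; <-≤-trans; m≤m+n; m≤n+m; +-suc; +-identityʳ)
  open import Relation.Binary.PropositionalEquality using (sym)

  -- Cantor's pairing function ⟨a , b⟩ = a + (a+b)(a+b+1)/2 and its inverse,
  -- which walks the anti-diagonals one step at a time.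

  triangle : ℕ → ℕ
  triangle zero    = zero
  triangle (suc n) = suc n + triangle n

  pair : ℕ → ℕ → ℕ
  pair a b = a + triangle (a + b)

  step : ℕ × ℕ → ℕ × ℕ
  step (a , zero)  = (zero , suc a)
  step (a , suc b) = (suc a , b)

  steps : ℕ → ℕ × ℕ → ℕ × ℕ
  steps zero    p = p
  steps (suc k) p = step (steps k p)

  unpair : ℕ → ℕ × ℕ
  unpair n = steps n (0 , 0)

  steps-+ : ∀ k n p → steps (k + n) p ≡ steps k (steps n p)
  steps-+ zero    n p = refl
  steps-+ (suc k) n p = cong step (steps-+ k n p)

  along-diagonal : ∀ a c b → steps a (c , a + b) ≡ (c + a , b)
  along-diagonal zero c b = cong (_, b) (sym (+-identityʳ c))
  along-diagonal (suc a) c b = begin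
    step (steps a (c , suc (a + b)))  ≡⟨ cong (λ m → step (steps a (c , m))) (sym (+-suc a b)) ⟩
    step (steps a (c , a + suc b))    ≡⟨ cong step (along-diagonal a c (suc b)) ⟩
    (suc (c + a) , b)                 ≡⟨ cong (_, b) (sym (+-suc c a)) ⟩
    (c + suc a , b)                   ∎
    where open ≡-Reasoning

  unpair-triangle : ∀ d → unpair (triangle d) ≡ (0 , d)
  unpair-triangle zero    = refl
  unpair-triangle (suc d) = begin
    steps (suc d + triangle d) (0 , 0)  ≡⟨ steps-+ (suc d) (triangle d) (0 , 0) ⟩
    step (steps d (unpair (triangle d))) ≡⟨ cong (λ p → step (steps d p)) (unpair-triangle d) ⟩
    step (steps d (0 , d))               ≡⟨ cong (λ m → step (steps d (0 , m))) (sym (+-identityʳ d)) ⟩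
    step (steps d (0 , d + 0))           ≡⟨ cong step (along-diagonal d 0 0) ⟩
    (0 , suc d)                          ∎
    where open ≡-Reasoning

  unpair-pair : ∀ a b → unpair (pair a b) ≡ (a , b)
  unpair-pair a b = begin
    steps (a + triangle (a + b)) (0 , 0)  ≡⟨ steps-+ a (triangle (a + b)) (0 , 0) ⟩
    steps a (unpair (triangle (a + b)))   ≡⟨ cong (steps a) (unpair-triangle (a + b)) ⟩
    steps a (0 , a + b)                   ≡⟨ along-diagonal a 0 b ⟩
    (a , b)                               ∎
    where open ≡-Reasoning

  -- Both components are bounded by the code; a payload is strictly below
  -- its code as soon as the tag is positive.  These bounds justify decoding
  -- with fuel.
  triangle-≥ : ∀ n → n ≤ triangle n
  triangle-≥ zero    = z≤n
  triangle-≥ (suc n) = m≤m+n (suc n) (triangle n)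

  pair-≥-sum : ∀ a b → a + b ≤ pair a b
  pair-≥-sum a b = ≤-trans (triangle-≥ (a + b)) (m≤n+m _ a)

  pair-≥ʳ : ∀ a b → b ≤ pair a b
  pair-≥ʳ a b = ≤-trans (m≤n+m b a) (pair-≥-sum a b)

  payload-< : ∀ k n → n < pair (suc k) n
  payload-< k n = ≤-trans (s≤s (m≤n+m n k)) (pair-≥-sum (suc k) n)

  node-children-< : ∀ k a c {f} → pair (suc k) (pair a c) ≤ f → a < f × c < f
  node-children-< k a c below =
      <-≤-trans (≤-<-trans (m≤m+n a _) (payload-< k (pair a c))) below
    , <-≤-trans (≤-<-trans (pair-≥ʳ a c) (payload-< k (pair a c))) below

  encodeTm : Tm → ℕ
  encodeTm (vr n)  = pair 0 n
  encodeTm (cn n)  = pair 1 n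
  encodeTm (t ⊕ s) = pair 2 (pair (encodeTm t) (encodeTm s))
  encodeTm (t ⊙ s) = pair 3 (pair (encodeTm t) (encodeTm s))
  encodeTm (! t)   = pair 4 (encodeTm t)

  encodeFm : FmJ → ℕ
  encodeFm ⊥ⱼ       = pair 0 0
  encodeFm (pⱼ i)   = pair 1 i
  encodeFm (φ ∧ⱼ ψ) = pair 2 (pair (encodeFm φ) (encodeFm ψ))
  encodeFm (φ ∨ⱼ ψ) = pair 3 (pair (encodeFm φ) (encodeFm ψ))
  encodeFm (φ ⇒ⱼ ψ) = pair 4 (pair (encodeFm φ) (encodeFm ψ))
  encodeFm (t ∶ ψ)  = pair 5 (pair (encodeTm t) (encodeFm ψ))

  decodeTm : ℕ → ℕ → Tm
  decodeTm zero    n = vr 0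
  decodeTm (suc f) n with unpair n
  ... | (0 , b) = vr b
  ... | (1 , b) = cn b
  ... | (2 , b) = decodeTm f (proj₁ (unpair b)) ⊕ decodeTm f (proj₂ (unpair b))
  ... | (3 , b) = decodeTm f (proj₁ (unpair b)) ⊙ decodeTm f (proj₂ (unpair b))
  ... | (4 , b) = ! decodeTm f b
  ... | _       = vr 0

  decodeFm : ℕ → ℕ → FmJ
  decodeFm zero    n = ⊥ⱼ
  decodeFm (suc f) n with unpair n
  ... | (0 , b) = ⊥ⱼ
  ... | (1 , b) = pⱼ b
  ... | (2 , b) = decodeFm f (proj₁ (unpair b)) ∧ⱼ decodeFm f (proj₂ (unpair b))
  ... | (3 , b) = decodeFm f (proj₁ (unpair b)) ∨ⱼ decodeFm f (proj₂ (unpair b))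
  ... | (4 , b) = decodeFm f (proj₁ (unpair b)) ⇒ⱼ decodeFm f (proj₂ (unpair b))
  ... | (5 , b) = decodeTm f (proj₁ (unpair b)) ∶ decodeFm f (proj₂ (unpair b))
  ... | _       = ⊥ⱼ

  decodeTm-encodeTm : ∀ t f → encodeTm t < f → decodeTm f (encodeTm t) ≡ t
  decodeTm-encodeTm (vr n) (suc f) _ rewrite unpair-pair 0 n = refl
  decodeTm-encodeTm (cn n) (suc f) _ rewrite unpair-pair 1 n = refl
  decodeTm-encodeTm (t ⊕ s) (suc f) (s≤s below)
    rewrite unpair-pair 2 (pair (encodeTm t) (encodeTm s)) | unpair-pair (encodeTm t) (encodeTm s)
    with node-children-< 1 (encodeTm t) (encodeTm s) below
  ... | t< , s< = cong₂ _⊕_ (decodeTm-encodeTm t f t<) (decodeTm-encodeTm s f s<)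
  decodeTm-encodeTm (t ⊙ s) (suc f) (s≤s below)
    rewrite unpair-pair 3 (pair (encodeTm t) (encodeTm s)) | unpair-pair (encodeTm t) (encodeTm s)
    with node-children-< 2 (encodeTm t) (encodeTm s) below
  ... | t< , s< = cong₂ _⊙_ (decodeTm-encodeTm t f t<) (decodeTm-encodeTm s f s<)
  decodeTm-encodeTm (! t) (suc f) (s≤s below) rewrite unpair-pair 4 (encodeTm t) =
    cong !_ (decodeTm-encodeTm t f (<-≤-trans (payload-< 3 (encodeTm t)) below))

  decodeFm-encodeFm : ∀ φ f → encodeFm φ < f → decodeFm f (encodeFm φ) ≡ φ
  decodeFm-encodeFm ⊥ⱼ (suc f) _ rewrite unpair-pair 0 0 = refl
  decodeFm-encodeFm (pⱼ i) (suc f) _ rewrite unpair-pair 1 i = refl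
  decodeFm-encodeFm (φ ∧ⱼ ψ) (suc f) (s≤s below)
    rewrite unpair-pair 2 (pair (encodeFm φ) (encodeFm ψ)) | unpair-pair (encodeFm φ) (encodeFm ψ)
    with node-children-< 1 (encodeFm φ) (encodeFm ψ) below
  ... | φ< , ψ< = cong₂ _∧ⱼ_ (decodeFm-encodeFm φ f φ<) (decodeFm-encodeFm ψ f ψ<)
  decodeFm-encodeFm (φ ∨ⱼ ψ) (suc f) (s≤s below)
    rewrite unpair-pair 3 (pair (encodeFm φ) (encodeFm ψ)) | unpair-pair (encodeFm φ) (encodeFm ψ)
    with node-children-< 2 (encodeFm φ) (encodeFm ψ) below
  ... | φ< , ψ< = cong₂ _∨ⱼ_ (decodeFm-encodeFm φ f φ<) (decodeFm-encodeFm ψ f ψ<)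
  decodeFm-encodeFm (φ ⇒ⱼ ψ) (suc f) (s≤s below)
    rewrite unpair-pair 4 (pair (encodeFm φ) (encodeFm ψ)) | unpair-pair (encodeFm φ) (encodeFm ψ)
    with node-children-< 3 (encodeFm φ) (encodeFm ψ) below
  ... | φ< , ψ< = cong₂ _⇒ⱼ_ (decodeFm-encodeFm φ f φ<) (decodeFm-encodeFm ψ f ψ<)
  decodeFm-encodeFm (t ∶ ψ) (suc f) (s≤s below)
    rewrite unpair-pair 5 (pair (encodeTm t) (encodeFm ψ)) | unpair-pair (encodeTm t) (encodeFm ψ)
    with node-children-< 4 (encodeTm t) (encodeFm ψ) below
  ... | t< , ψ< = cong₂ _∶_ (decodeTm-encodeTm t f t<) (decodeFm-encodeFm ψ f ψ<)

open GödelNumbering using (encodeFm; decodeFm; decodeFm-encodeFm)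

imps₀ : List Fm₀ → Fm₀ → Fm₀
imps₀ []       B = B
imps₀ (γ ∷ γs) B = γ ⇒₀ imps₀ γs B

impsⱼ : List FmJ → FmJ → FmJ
impsⱼ []       B = B
impsⱼ (γ ∷ γs) B = γ ⇒ⱼ impsⱼ γs B

module FrameOrder (F : Frame) where
  open Frame F public
  open IsPartialOrder isPO public using () renaming (refl to ≤-refl; trans to ≤-trans)

module KripkeFacts {F : Frame} (K : KModel F) where
  open FrameOrder F
  open KModel K

  sat : W → Fm₀ → Set
  sat = _⊨₀_ K

  persist : ∀ φ {x y} → x ≤ y → sat x φ → sat y φ
  persist ⊥₀       x≤y ()
  persist (p₀ i)   x≤y h        = mono x≤y h
  persist (φ ∧₀ ψ) x≤y (a , b)  = persist φ x≤y a , persist ψ x≤y b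
  persist (φ ∨₀ ψ) x≤y (inj₁ a) = inj₁ (persist φ x≤y a)
  persist (φ ∨₀ ψ) x≤y (inj₂ b) = inj₂ (persist ψ x≤y b)
  persist (φ ⇒₀ ψ) x≤y h        = λ z y≤z → h z (≤-trans x≤y y≤z)

  ⋀₀-intro : ∀ {x} γs → All (sat x) γs → sat x (⋀₀ γs)
  ⋀₀-intro []           _        = λ _ _ ()
  ⋀₀-intro (γ ∷ [])     (h ∷ []) = h
  ⋀₀-intro (γ ∷ δ ∷ γs) (h ∷ hs) = h , ⋀₀-intro (δ ∷ γs) hs

  ⋀₀-elim : ∀ {x} γs → sat x (⋀₀ γs) → All (sat x) γs
  ⋀₀-elim []           _        = []
  ⋀₀-elim (γ ∷ [])     h        = h ∷ []
  ⋀₀-elim (γ ∷ δ ∷ γs) (h , hs) = h ∷ ⋀₀-elim (δ ∷ γs) hs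

  imps₀-intro : ∀ {x} γs B → (∀ y → x ≤ y → All (sat y) γs → sat y B) → sat x (imps₀ γs B)
  imps₀-intro []       B h = h _ ≤-refl []
  imps₀-intro (γ ∷ γs) B h = λ y x≤y hγ →
    imps₀-intro γs B λ z y≤z hγs → h z (≤-trans x≤y y≤z) (persist γ y≤z hγ ∷ hγs)

module MkrtychevFacts {F : Frame} (M : MModel F) where
  open FrameOrder F
  open MModel M

  sat : W → FmJ → Set
  sat = _⊨ⱼ_ M

  persist : ∀ φ {x y} → x ≤ y → sat x φ → sat y φ
  persist ⊥ⱼ       x≤y ()
  persist (pⱼ i)   x≤y h        = mono⊩ x≤y h
  persist (φ ∧ⱼ ψ) x≤y (a , b)  = persist φ x≤y a , persist ψ x≤y b
  persist (φ ∨ⱼ ψ) x≤y (inj₁ a) = inj₁ (persist φ x≤y a)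
  persist (φ ∨ⱼ ψ) x≤y (inj₂ b) = inj₂ (persist ψ x≤y b)
  persist (φ ⇒ⱼ ψ) x≤y h        = λ z y≤z → h z (≤-trans x≤y y≤z)
  persist (t ∶ φ)  x≤y h        = monoE x≤y h

  ⋀ⱼ-intro : ∀ {x} γs → All (sat x) γs → sat x (⋀ⱼ γs)
  ⋀ⱼ-intro []           _        = λ _ _ ()
  ⋀ⱼ-intro (γ ∷ [])     (h ∷ []) = h
  ⋀ⱼ-intro (γ ∷ δ ∷ γs) (h ∷ hs) = h , ⋀ⱼ-intro (δ ∷ γs) hs

factive-of : ∀ v {F} (M : MModel F) → VariantCond v M → HasF v → Factive M
factive-of LJT  M cond        _ = cond
factive-of LJT4 M (fact , _)  _ = fact

introspective-of : ∀ v {F} (M : MModel F) → VariantCond v M → HasI v → Introspective M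
introspective-of LJ4  M cond       _ = cond
introspective-of LJT4 M (_ , intr) _ = intr

variantCond : ∀ v {F} (M : MModel F) →
  (HasF v → Factive M) → (HasI v → Introspective M) → VariantCond v M
variantCond LJ   M fact intr = tt
variantCond LJT  M fact intr = fact tt
variantCond LJ4  M fact intr = intr tt
variantCond LJT4 M fact intr = fact tt , intr tt

Valid : (Frame → Set) → Fm₀ → Set₁
Valid C ψ = ∀ F → C F → (K : KModel F) → ∀ x → _⊨₀_ K x ψ

module _ {L : Fm₀ → Set} (IL : IntermediateLogic L) {C : Frame → Set}
         (SC : StronglyComplete L C) where
  open IntermediateLogic IL renaming (mp to mpL)

  theorem-valid : ∀ {ψ} → L ψ → Valid C ψ
  theorem-valid {ψ} Lψ F cF K x =
    proj₁ (SC (λ _ → ⊥) ψ) ([] , [] , mpL ψ _ (axioms _ (ax1 ψ (⊥₀ ⇒₀ ⊥₀))) Lψ) F cF K x (λ _ ())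

  valid-theorem : ∀ {ψ} → Valid C ψ → L ψ
  valid-theorem {ψ} valid with proj₂ (SC (λ _ → ⊥) ψ) (λ F cF K x _ → valid F cF K x)
  ... | []    , _     , ⊤→ψ = mpL _ ψ ⊤→ψ (axioms _ (ax9 ⊥₀))
  ... | _ ∷ _ , () ∷ _ , _

module Soundness {F : Frame} (M : MModel F) where
  open FrameOrder F
  open MModel M
  open MkrtychevFacts M

  substModel : (ℕ → FmJ) → KModel F
  substModel σ = record { _⊩_ = λ x i → sat x (σ i) ; mono = λ {_} {_} {i} → persist (σ i) }

  mutual
    substModel-sat : ∀ σ ψ {x} → _⊨₀_ (substModel σ) x ψ → sat x (substJ σ ψ)
    substModel-sat σ ⊥₀       h        = h
    substModel-sat σ (p₀ i)   h        = h
    substModel-sat σ (φ ∧₀ ψ) (a , b)  = substModel-sat σ φ a , substModel-sat σ ψ b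
    substModel-sat σ (φ ∨₀ ψ) (inj₁ a) = inj₁ (substModel-sat σ φ a)
    substModel-sat σ (φ ∨₀ ψ) (inj₂ b) = inj₂ (substModel-sat σ ψ b)
    substModel-sat σ (φ ⇒₀ ψ) h        =
      λ y x≤y a → substModel-sat σ ψ (h y x≤y (substModel-sat⁻ σ φ a))

    substModel-sat⁻ : ∀ σ ψ {x} → sat x (substJ σ ψ) → _⊨₀_ (substModel σ) x ψ
    substModel-sat⁻ σ ⊥₀       h        = h
    substModel-sat⁻ σ (p₀ i)   h        = h
    substModel-sat⁻ σ (φ ∧₀ ψ) (a , b)  = substModel-sat⁻ σ φ a , substModel-sat⁻ σ ψ b
    substModel-sat⁻ σ (φ ∨₀ ψ) (inj₁ a) = inj₁ (substModel-sat⁻ σ φ a)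
    substModel-sat⁻ σ (φ ∨₀ ψ) (inj₂ b) = inj₂ (substModel-sat⁻ σ ψ b)
    substModel-sat⁻ σ (φ ⇒₀ ψ) h        =
      λ y x≤y a → substModel-sat⁻ σ ψ (h y x≤y (substModel-sat σ φ a))

  scheme-sat : ∀ {v χ} → VariantCond v M → JustAx v χ → ∀ x → sat x χ
  scheme-sat cond (axJ t s φ ψ) x = λ y _ e₁ z y≤z e₂ → app (monoE y≤z e₁) e₂
  scheme-sat cond (axP₁ t s φ)  x = λ y _ e → sumˡ e
  scheme-sat cond (axP₂ t s φ)  x = λ y _ e → sumʳ e
  scheme-sat {v} cond (axF hasF t φ) x = λ y _ e → factive-of v M cond hasF t y φ e
  scheme-sat {v} cond (axI hasI t φ) x = λ y _ e → introspective-of v M cond hasI t y φ e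

  LJL₀-sat : ∀ {L v χ} → (∀ {ψ} → L ψ → ∀ (K : KModel F) x → _⊨₀_ K x ψ) →
    VariantCond v M → LJL₀ L v χ → ∀ x → sat x χ
  LJL₀-sat L-sat cond (lbar _ (ψ , σ , Lψ , refl)) x =
    substModel-sat σ ψ (L-sat Lψ (substModel σ) x)
  LJL₀-sat L-sat cond (jax _ scheme) x = scheme-sat cond scheme x
  LJL₀-sat L-sat cond (mp φ _ d₁ d₂) x = LJL₀-sat L-sat cond d₁ x x ≤-refl (LJL₀-sat L-sat cond d₂ x)

soundness : ∀ {L v CS C Γ φ} → IntermediateLogic L → IsCS L v CS → StronglyComplete L C →
  Derivable L v CS Γ φ → SemConseq C v CS Γ φ
soundness {CS = CS} {Γ = Γ} IL isCS SC (γs , γs-ok , d) F cF M cond respects x Γ-hold =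
  LJL₀-sat (λ Lψ → theorem-valid IL SC Lψ F cF) cond d x x ≤-refl (⋀ⱼ-intro γs (All.map premise-sat γs-ok))
  where
  open FrameOrder F
  open Soundness M
  open MkrtychevFacts M

  -- members of CS have the form c : ψ, so M respecting CS makes them true
  premise-sat : ∀ {γ} → Γ γ ⊎ CS γ → sat x γ
  premise-sat {γ} (inj₁ inΓ) = Γ-hold γ inΓ
  premise-sat {γ} (inj₂ inCS) with isCS γ inCS
  ... | c , cs , ψ , refl , _ = respects c (prefixCs cs ψ) inCS x

-- The propositional skeleton of a formula of 𝓛_J: every atom p_i or t:ψ
-- becomes the variable 1 + (its code); variable 0 does not occur.
atomVar : FmJ → ℕ
atomVar χ = suc (encodeFm χ)

skeleton : FmJ → Fm₀
skeleton ⊥ⱼ       = ⊥₀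
skeleton (pⱼ i)   = p₀ (atomVar (pⱼ i))
skeleton (φ ∧ⱼ ψ) = skeleton φ ∧₀ skeleton ψ
skeleton (φ ∨ⱼ ψ) = skeleton φ ∨₀ skeleton ψ
skeleton (φ ⇒ⱼ ψ) = skeleton φ ⇒₀ skeleton ψ
skeleton (t ∶ ψ)  = p₀ (atomVar (t ∶ ψ))

readBack : ℕ → FmJ
readBack zero    = ⊥ⱼ ⇒ⱼ ⊥ⱼ
readBack (suc n) = decodeFm (suc n) n

readBack-skeleton : ∀ χ → substJ readBack (skeleton χ) ≡ χ
readBack-skeleton ⊥ⱼ       = refl
readBack-skeleton (pⱼ i)   = decodeFm-encodeFm (pⱼ i) _ (n<1+n _)
readBack-skeleton (φ ∧ⱼ ψ) = cong₂ _∧ⱼ_ (readBack-skeleton φ) (readBack-skeleton ψ)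
readBack-skeleton (φ ∨ⱼ ψ) = cong₂ _∨ⱼ_ (readBack-skeleton φ) (readBack-skeleton ψ)
readBack-skeleton (φ ⇒ⱼ ψ) = cong₂ _⇒ⱼ_ (readBack-skeleton φ) (readBack-skeleton ψ)
readBack-skeleton (t ∶ ψ)  = decodeFm-encodeFm (t ∶ ψ) _ (n<1+n _)

readBack-⋀ : ∀ γs → substJ readBack (⋀₀ (map skeleton γs)) ≡ ⋀ⱼ γs
readBack-⋀ []           = refl
readBack-⋀ (γ ∷ [])     = readBack-skeleton γ
readBack-⋀ (γ ∷ δ ∷ γs) = cong₂ _∧ⱼ_ (readBack-skeleton γ) (readBack-⋀ (δ ∷ γs))

readBack-imps : ∀ γs B → substJ readBack (imps₀ (map skeleton γs) B) ≡ impsⱼ γs (substJ readBack B)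
readBack-imps []       B = refl
readBack-imps (γ ∷ γs) B = cong₂ _⇒ⱼ_ (readBack-skeleton γ) (readBack-imps γs B)

readBack-instance : ∀ {L v ψ} → L ψ → LJL₀ L v (substJ readBack ψ)
readBack-instance {ψ = ψ} Lψ = lbar _ (ψ , readBack , Lψ , refl)

discharge : ∀ {L v} γs B → All (LJL₀ L v) γs → LJL₀ L v (impsⱼ γs B) → LJL₀ L v B
discharge []       B []       d = d
discharge (γ ∷ γs) B (dγ ∷ ds) d = discharge γs B ds (mp γ _ d dγ)

module Canonical {F : Frame} (K : KModel F) (v : Variant)
                 (schemes-hold : ∀ x {χ} → JustAx v χ → _⊨₀_ K x (skeleton χ)) where
  open FrameOrder F
  open KModel K

  model : MModel F
  model = record
    { _⊩_   = λ x i → x ⊩ atomVar (pⱼ i)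
    ; E     = λ t x ψ → x ⊩ atomVar (t ∶ ψ)
    ; mono⊩ = mono
    ; monoE = mono
    ; app   = λ {x} {t} {s} {φ} {ψ} e₁ e₂ → schemes-hold x (axJ t s ψ φ) x ≤-refl e₁ x ≤-refl e₂
    ; sumˡ  = λ {x} {t} {s} {φ} e → schemes-hold x (axP₁ t s φ) x ≤-refl e
    ; sumʳ  = λ {x} {t} {s} {φ} e → schemes-hold x (axP₂ s t φ) x ≤-refl e
    }

  mutual
    truth : ∀ χ {x} → _⊨ⱼ_ model x χ → _⊨₀_ K x (skeleton χ)
    truth ⊥ⱼ       h        = h
    truth (pⱼ i)   h        = h
    truth (φ ∧ⱼ ψ) (a , b)  = truth φ a , truth ψ b
    truth (φ ∨ⱼ ψ) (inj₁ a) = inj₁ (truth φ a)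
    truth (φ ∨ⱼ ψ) (inj₂ b) = inj₂ (truth ψ b)
    truth (φ ⇒ⱼ ψ) h        = λ y x≤y a → truth ψ (h y x≤y (truth⁻ φ a))
    truth (t ∶ ψ)  h        = h

    truth⁻ : ∀ χ {x} → _⊨₀_ K x (skeleton χ) → _⊨ⱼ_ model x χ
    truth⁻ ⊥ⱼ       h        = h
    truth⁻ (pⱼ i)   h        = h
    truth⁻ (φ ∧ⱼ ψ) (a , b)  = truth⁻ φ a , truth⁻ ψ b
    truth⁻ (φ ∨ⱼ ψ) (inj₁ a) = inj₁ (truth⁻ φ a)
    truth⁻ (φ ∨ⱼ ψ) (inj₂ b) = inj₂ (truth⁻ ψ b)
    truth⁻ (φ ⇒ⱼ ψ) h        = λ y x≤y a → truth⁻ ψ (h y x≤y (truth φ a))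
    truth⁻ (t ∶ ψ)  h        = h

  conditions : VariantCond v model
  conditions = variantCond v model
    (λ hasF t x φ e → truth⁻ φ (schemes-hold x (axF hasF t φ) x ≤-refl e))
    (λ hasI t x φ e → schemes-hold x (axI hasI t φ) x ≤-refl e)

  respects : ∀ {CS} → (∀ x {χ} → CS χ → _⊨₀_ K x (skeleton χ)) → RespectsCS model CS
  respects CS-hold c φ inCS x = CS-hold x inCS

-- Propositional premises expressing consequence from Γ in LJL_CS: skeletons of
-- scheme instances and of CS, and p₀ → γ for γ ∈ Γ, the spare variable p₀
-- marking the worlds at which Γ is assumed.
data Premise (v : Variant) (CS Γ : FmJ → Set) : Fm₀ → Set where
  scheme : ∀ {χ} → JustAx v χ → Premise v CS Γ (skeleton χ)
  spec   : ∀ {χ} → CS χ → Premise v CS Γ (skeleton χ)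
  hyp    : ∀ {γ} → Γ γ → Premise v CS Γ (p₀ 0 ⇒₀ skeleton γ)

module Premises {v : Variant} {CS Γ : FmJ → Set} where

  schemesOf : ∀ {θs} → All (Premise v CS Γ) θs → List FmJ
  schemesOf []                  = []
  schemesOf (scheme {χ} _ ∷ ps) = χ ∷ schemesOf ps
  schemesOf (spec _ ∷ ps)       = schemesOf ps
  schemesOf (hyp _ ∷ ps)        = schemesOf ps

  hypsOf : ∀ {θs} → All (Premise v CS Γ) θs → List FmJ
  hypsOf []                = []
  hypsOf (scheme _ ∷ ps)   = hypsOf ps
  hypsOf (spec {χ} _ ∷ ps) = χ ∷ hypsOf ps
  hypsOf (hyp {γ} _ ∷ ps)  = γ ∷ hypsOf ps

  schemesOf-schemes : ∀ {θs} (ps : All (Premise v CS Γ) θs) → All (JustAx v) (schemesOf ps)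
  schemesOf-schemes []              = []
  schemesOf-schemes (scheme j ∷ ps) = j ∷ schemesOf-schemes ps
  schemesOf-schemes (spec _ ∷ ps)   = schemesOf-schemes ps
  schemesOf-schemes (hyp _ ∷ ps)    = schemesOf-schemes ps

  hypsOf-hyps : ∀ {θs} (ps : All (Premise v CS Γ) θs) → All (λ γ → Γ γ ⊎ CS γ) (hypsOf ps)
  hypsOf-hyps []              = []
  hypsOf-hyps (scheme _ ∷ ps) = hypsOf-hyps ps
  hypsOf-hyps (spec c ∷ ps)   = inj₂ c ∷ hypsOf-hyps ps
  hypsOf-hyps (hyp g ∷ ps)    = inj₁ g ∷ hypsOf-hyps ps

  -- Where the skeletons of both parts hold, all premises hold (p₀ → γ even
  -- without p₀, by persistence of γ).
  premises-hold : ∀ {F} (K : KModel F) {x θs} (ps : All (Premise v CS Γ) θs) →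
    All (λ χ → _⊨₀_ K x (skeleton χ)) (schemesOf ps) →
    All (λ χ → _⊨₀_ K x (skeleton χ)) (hypsOf ps) → All (_⊨₀_ K x) θs
  premises-hold K []               _         _         = []
  premises-hold K (scheme _ ∷ ps)  (h ∷ hjs) hds       = h ∷ premises-hold K ps hjs hds
  premises-hold K (spec _ ∷ ps)    hjs       (h ∷ hds) = h ∷ premises-hold K ps hjs hds
  premises-hold K (hyp {γ} _ ∷ ps) hjs       (h ∷ hds) =
    (λ y x≤y _ → persist (skeleton γ) x≤y h) ∷ premises-hold K ps hjs hds
    where open KripkeFacts K

  rearrangement : ∀ {θs} → All (Premise v CS Γ) θs → FmJ → Fm₀
  rearrangement ps φ =
    imps₀ (map skeleton (schemesOf ps)) (⋀₀ (map skeleton (hypsOf ps)) ⇒₀ skeleton φ)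

  -- The L-formula turning a derivation of p₀ → φ from the premises into one of
  -- the rearrangement under the extra assumption p₀ (later read as ⊤).
  bridge : ∀ {θs} → All (Premise v CS Γ) θs → FmJ → Fm₀
  bridge {θs} ps φ = (⋀₀ θs ⇒₀ p₀ 0 ⇒₀ skeleton φ) ⇒₀ p₀ 0 ⇒₀ rearrangement ps φ

  bridge-true : ∀ {F} (K : KModel F) {θs} (ps : All (Premise v CS Γ) θs) φ x →
    _⊨₀_ K x (bridge ps φ)
  bridge-true {F} K {θs} ps φ x y x≤y derivation z y≤z p₀-holds =
    imps₀-intro (map skeleton (schemesOf ps)) _ λ w z≤w schemes-hold w′ w≤w′ hyps-hold →
      derivation w′ (≤-trans y≤z (≤-trans z≤w w≤w′))
        (⋀₀-intro θs (premises-hold K ps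
          (All.map (λ {χ} → persist (skeleton χ) w≤w′) (map⁻ schemes-hold))
          (map⁻ (⋀₀-elim (map skeleton (hypsOf ps)) hyps-hold))))
        w′ ≤-refl (persist (p₀ 0) (≤-trans z≤w w≤w′) p₀-holds)
    where
    open FrameOrder F
    open KripkeFacts K

open Premises

premises-entail : ∀ {C v CS Γ φ} → SemConseq C v CS Γ φ →
  ∀ F → C F → (K : KModel F) → (∀ x θ → Premise v CS Γ θ → _⊨₀_ K x θ) →
  ∀ x → _⊨₀_ K x (p₀ 0 ⇒₀ skeleton φ)
premises-entail {v = v} {φ = φ} sem F cF K premises-hold x y x≤y p₀-holds =
  truth φ (sem F cF model conditions (respects λ z {χ} inCS → premises-hold z (skeleton χ) (spec inCS)) y
             λ γ inΓ → truth⁻ γ (premises-hold y _ (hyp inΓ) y ≤-refl p₀-holds))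
  where
  open FrameOrder F
  open Canonical K v (λ z j → premises-hold z _ (scheme j))

-- An L-derivation of p₀ → φ from finitely many premises yields an
-- LJL₀-derivation of ⋀ Δ → φ, Δ the hypotheses among the premises: apply
-- readBack to it and to the bridge, then discharge ⊤ and the scheme instances.
derive-from-premises : ∀ {L C v CS Γ θs} → IntermediateLogic L → StronglyComplete L C →
  (ps : All (Premise v CS Γ) θs) → ∀ φ → L (⋀₀ θs ⇒₀ p₀ 0 ⇒₀ skeleton φ) →
  LJL₀ L v (⋀ⱼ (hypsOf ps) ⇒ⱼ φ)
derive-from-premises {L} {v = v} IL SC ps φ derivation =
  discharge schemes _ (All.map (jax _) (schemesOf-schemes ps))
    (subst (LJL₀ L v) read-back-goal (mp _ _ rearranged (readBack-instance (axioms _ (ax9 ⊥₀)))))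
  where
  open IntermediateLogic IL using (axioms)
  open ≡-Reasoning
  schemes hyps : List FmJ
  schemes = schemesOf ps
  hyps    = hypsOf ps

  bridge-theorem : L (bridge ps φ)
  bridge-theorem = valid-theorem IL SC λ F _ K → bridge-true K ps φ

  rearranged : LJL₀ L v (substJ readBack (p₀ 0 ⇒₀ rearrangement ps φ))
  rearranged = mp _ _ (readBack-instance bridge-theorem) (readBack-instance derivation)

  read-back-goal : substJ readBack (rearrangement ps φ) ≡ impsⱼ schemes (⋀ⱼ hyps ⇒ⱼ φ)
  read-back-goal = begin
    substJ readBack (rearrangement ps φ)
      ≡⟨ readBack-imps schemes _ ⟩
    impsⱼ schemes (substJ readBack (⋀₀ (map skeleton hyps)) ⇒ⱼ substJ readBack (skeleton φ))
      ≡⟨ cong (impsⱼ schemes) (cong₂ _⇒ⱼ_ (readBack-⋀ hyps) (readBack-skeleton φ)) ⟩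
    impsⱼ schemes (⋀ⱼ hyps ⇒ⱼ φ)
      ∎

completeness : ∀ {L v CS C Γ φ} → IntermediateLogic L → StronglyComplete L C →
  StronglyGloballyComplete L C → SemConseq C v CS Γ φ → Derivable L v CS Γ φ
completeness {v = v} {CS} {Γ = Γ} {φ} IL SC SGC sem
  with proj₂ (SGC (Premise v CS Γ) (p₀ 0 ⇒₀ skeleton φ)) (premises-entail {φ = φ} sem)
... | _ , ps , derivation = hypsOf ps , hypsOf-hyps ps , derive-from-premises IL SC ps φ derivation

mainTheorem5 : (L : Fm₀ → Set) → IntermediateLogic L →
    (v : Variant) → (CS : FmJ → Set) → IsCS L v CS →
    (C : Frame → Set) → StronglyComplete L C → StronglyGloballyComplete L C →
    (Γ : FmJ → Set) → (φ : FmJ) →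
    (Derivable L v CS Γ φ → SemConseq C v CS Γ φ)
    × (SemConseq C v CS Γ φ → Derivable L v CS Γ φ)
mainTheorem5 L IL v CS isCS C SC SGC Γ φ = soundness IL isCS SC , completeness IL SC SGC
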